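{- Let $r$ be a nonnegative integer. For every integer $n\ge 2r+1$, $$\varphi_r(n):=\binom{2n-1}{2r+1}-2\sum_{k=r+1}^{n-r-1}\binom{2k-1}{r}\binom{2n-2k-1}{r}=(-1)^r\binom{n-1}{r}+4\sum_{k=1}^{r}\binom{2k-1}{r}\binom{2n-2k-1}{r},$$ and the right-hand side, regarded as a polynomial in $n$ (with $\binom{m}{r}=m(m-1)\cdots(m-r+1)/r!$), has degree at most $r$.
   Context: For integers $a\ge0$ and $b$, $\binom{a}{b}=0$ if $b<0$ or $b>a$; empty sums are $0$. -}

module Defs where

open import Data.Nat using (ℕ; zero; suc; _+_; _*_; _∸_)
open import Data.Nat.Combinatorics using (_C_)
open import Data.List using (map; upTo)
open import Data.Integer using (ℤ; +_; -_) renaming (_+_ to _+ℤ_; _-_ to _-ℤ_; _*_ to _*ℤ_)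
open import Data.Integer.Base as ℤ using ()
open import Data.Nat.ListAction using (sum)
open import Data.Vec using (Vec; []; _∷_)
open import Data.Rational using (ℚ; 0ℚ) renaming (_+_ to _+ℚ_; _*_ to _*ℚ_)
import Data.Rational as ℚ

-- Σ_{k=a}^{b} f k over natural numbers (empty, i.e. 0, if b < a)
sumFromTo : ℕ → ℕ → (ℕ → ℕ) → ℕ
sumFromTo a b f = sum (map (λ i → f (a + i)) (upTo (suc b ∸ a)))

signPow : ℕ → ℤ
signPow zero = + 1
signPow (suc r) = - signPow r

-- φ_r(n) = C(2n-1, 2r+1) - 2 Σ_{k=r+1}^{n-r-1} C(2k-1, r) C(2n-2k-1, r)
-- (for n ≥ 2r+1 all the truncated subtractions below are genuine)
phi : ℕ → ℕ → ℤ
phi r n = + ((2 * n ∸ 1) C (2 * r + 1))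
          -ℤ + (2 * sumFromTo (r + 1) (n ∸ r ∸ 1)
                   (λ k → ((2 * k ∸ 1) C r) * ((2 * n ∸ 2 * k ∸ 1) C r)))

rhs : ℕ → ℕ → ℤ
rhs r n = signPow r *ℤ + ((n ∸ 1) C r)
          +ℤ + (4 * sumFromTo 1 r
                   (λ k → ((2 * k ∸ 1) C r) * ((2 * n ∸ 2 * k ∸ 1) C r)))

evalPoly : ∀ {d} → Vec ℚ d → ℚ → ℚ
evalPoly [] x = 0ℚ
evalPoly (c ∷ cs) x = c +ℚ (x *ℚ evalPoly cs x)

ℤtoℚ : ℤ → ℚ
ℤtoℚ z = z ℚ./ 1

ℕtoℚ : ℕ → ℚ
ℕtoℚ n = ℤtoℚ (+ n)

{-# OPTIONS --safe #-}
module Submission where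

-- Vandermonde's convolution gives C(2n-1, 2r+1) = Σ_{j=0}^{2n-2} C(j, r) C(2n-2-j, r).
-- The alternating version of this sum equals (-1)^r C(n-1, r), since both sides satisfy
-- the same Pascal recursion in (r, n); comparing the two sums isolates the odd j = 2k-1:
--   C(2n-1, 2r+1) = (-1)^r C(n-1, r) + 2 Σ_{k=1}^{n-1} C(2k-1, r) C(2n-2k-1, r).
-- The summand is invariant under k ↦ n - k, so the terms with k ≥ n - r repeat those with
-- k ≤ r, and removing twice the middle range r < k < n - r leaves the right-hand side.
-- Each C(an - c, r) is a polynomial of degree r in n, built up from
-- C(N, j+1) = C(N, j) (N - j) / (j + 1), and the right-hand side combines such terms.

module Sums where
  open import Data.Nat as ℕ using (ℕ; zero; suc; _∸_; _<_)
  import Data.Nat.Properties as ℕ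
  open import Data.Nat.ListAction using (sum)
  open import Data.Nat.ListAction.Properties using (sum-++)
  open import Data.List using (map; upTo; _++_; [_])
  import Data.List.Properties as List
  open import Data.Integer using (ℤ; +_; -_; _+_; _*_; 0ℤ)
  import Data.Integer.Properties as ℤ
  open import Algebra.Properties.CommutativeSemigroup ℤ.+-commutativeSemigroup using (interchange)
  open import Data.Integer.Tactic.RingSolver using (solve-∀)
  open import Defs using (sumFromTo)
  open import Relation.Binary.PropositionalEquality
    using (_≡_; refl; sym; trans; cong; cong₂; module ≡-Reasoning)
  open ≡-Reasoning

  ∑ : ℕ → (ℕ → ℤ) → ℤ
  ∑ zero    f = 0ℤ
  ∑ (suc n) f = ∑ n f + f n

  ∑-cong : ∀ n {f g} → (∀ i → i < n → f i ≡ g i) → ∑ n f ≡ ∑ n g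
  ∑-cong zero    f≗g = refl
  ∑-cong (suc n) f≗g =
    cong₂ _+_ (∑-cong n (λ i i<n → f≗g i (ℕ.m<n⇒m<1+n i<n))) (f≗g n ℕ.≤-refl)

  ∑-+ : ∀ n f g → ∑ n (λ i → f i + g i) ≡ ∑ n f + ∑ n g
  ∑-+ zero    f g = refl
  ∑-+ (suc n) f g =
    trans (cong (_+ (f n + g n)) (∑-+ n f g)) (interchange (∑ n f) (∑ n g) (f n) (g n))

  ∑-neg : ∀ n f → ∑ n (λ i → - f i) ≡ - ∑ n f
  ∑-neg zero    f = refl
  ∑-neg (suc n) f = trans (cong (_+ - f n) (∑-neg n f)) (sym (ℤ.neg-distrib-+ (∑ n f) (f n)))

  ∑-suc : ∀ n f → ∑ (suc n) f ≡ f 0 + ∑ n (λ i → f (suc i))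
  ∑-suc zero    f = trans (ℤ.+-identityˡ (f 0)) (sym (ℤ.+-identityʳ (f 0)))
  ∑-suc (suc n) f = trans (cong (_+ f (suc n)) (∑-suc n f)) (ℤ.+-assoc (f 0) _ _)

  ∑-++ : ∀ m n f → ∑ (m ℕ.+ n) f ≡ ∑ m f + ∑ n (λ i → f (m ℕ.+ i))
  ∑-++ m zero    f =
    trans (cong (λ k → ∑ k f) (ℕ.+-identityʳ m)) (sym (ℤ.+-identityʳ (∑ m f)))
  ∑-++ m (suc n) f = begin
    ∑ (m ℕ.+ suc n) f                             ≡⟨ cong (λ k → ∑ k f) (ℕ.+-suc m n) ⟩
    ∑ (m ℕ.+ n) f + f (m ℕ.+ n)                   ≡⟨ cong (_+ f (m ℕ.+ n)) (∑-++ m n f) ⟩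
    ∑ m f + ∑ n (λ i → f (m ℕ.+ i)) + f (m ℕ.+ n) ≡⟨ ℤ.+-assoc (∑ m f) _ _ ⟩
    ∑ m f + ∑ (suc n) (λ i → f (m ℕ.+ i))         ∎

  ∑-reverse : ∀ n f → ∑ n f ≡ ∑ n (λ i → f (n ∸ suc i))
  ∑-reverse zero    f = refl
  ∑-reverse (suc n) f = begin
    ∑ n f + f n                         ≡⟨ cong (_+ f n) (∑-reverse n f) ⟩
    ∑ n (λ i → f (n ∸ suc i)) + f n     ≡⟨ ℤ.+-comm _ (f n) ⟩
    f n + ∑ n (λ i → f (n ∸ suc i))     ≡⟨ ∑-suc n (λ i → f (suc n ∸ suc i)) ⟨
    ∑ (suc n) (λ i → f (suc n ∸ suc i)) ∎

  +sum-upTo : ∀ n (g : ℕ → ℕ) → + sum (map g (upTo n)) ≡ ∑ n (λ i → + g i)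
  +sum-upTo zero    g = refl
  +sum-upTo (suc n) g = begin
    + sum (map g (upTo (suc n)))
      ≡⟨ cong (λ is → + sum (map g is)) (List.upTo-∷ʳ n) ⟨
    + sum (map g (upTo n ++ [ n ]))
      ≡⟨ cong (λ is → + sum is) (List.map-++ g (upTo n) [ n ]) ⟩
    + sum (map g (upTo n) ++ [ g n ])
      ≡⟨ cong +_ (sum-++ (map g (upTo n)) [ g n ]) ⟩
    + (sum (map g (upTo n)) ℕ.+ (g n ℕ.+ 0))
      ≡⟨ cong (λ s → + (sum (map g (upTo n)) ℕ.+ s)) (ℕ.+-identityʳ (g n)) ⟩
    + (sum (map g (upTo n)) ℕ.+ g n)
      ≡⟨ ℤ.pos-+ (sum (map g (upTo n))) (g n) ⟩
    + sum (map g (upTo n)) + + g n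
      ≡⟨ cong (_+ + g n) (+sum-upTo n g) ⟩
    ∑ n (λ i → + g i) + + g n ∎

  +sumFromTo-suc : ∀ a t g → + sumFromTo (suc a) (a ℕ.+ t) g ≡ ∑ t (λ i → + g (suc (a ℕ.+ i)))
  +sumFromTo-suc a t g = trans (+sum-upTo (a ℕ.+ t ∸ a) (λ i → g (suc (a ℕ.+ i))))
                               (cong (λ n → ∑ n (λ i → + g (suc (a ℕ.+ i)))) (ℕ.m+n∸m≡n a t))

  ∑-palindrome : ∀ a t f →
    (∀ i → i < a ℕ.+ (t ℕ.+ a) → f (a ℕ.+ (t ℕ.+ a) ∸ suc i) ≡ f i) →
    ∑ (a ℕ.+ (t ℕ.+ a)) f ≡ + 2 * ∑ a f + ∑ t (λ i → f (a ℕ.+ i))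
  ∑-palindrome a t f palindromic = begin
    ∑ (a ℕ.+ (t ℕ.+ a)) f
      ≡⟨ ∑-++ a (t ℕ.+ a) f ⟩
    ∑ a f + ∑ (t ℕ.+ a) (λ i → f (a ℕ.+ i))
      ≡⟨ cong (λ s → ∑ a f + s) (∑-++ t a (λ i → f (a ℕ.+ i))) ⟩
    ∑ a f + (middle + ∑ a (λ i → f (a ℕ.+ (t ℕ.+ i))))
      ≡⟨ cong (λ s → ∑ a f + (middle + s)) (trans (∑-reverse a _) (∑-cong a reflected)) ⟩
    ∑ a f + (middle + ∑ a f)
      ≡⟨ regroup (∑ a f) middle ⟩
    + 2 * ∑ a f + middle ∎
    where
    middle = ∑ t (λ i → f (a ℕ.+ i))
    regroup : ∀ x y → x + (y + x) ≡ + 2 * x + y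
    regroup = solve-∀
    reflected : ∀ i → i < a → f (a ℕ.+ (t ℕ.+ (a ∸ suc i))) ≡ f i
    reflected i i<a =
      trans (cong f index) (palindromic i (ℕ.<-≤-trans i<a (ℕ.m≤m+n a (t ℕ.+ a))))
      where
      index : a ℕ.+ (t ℕ.+ (a ∸ suc i)) ≡ a ℕ.+ (t ℕ.+ a) ∸ suc i
      index = sym (trans (ℕ.+-∸-assoc a (ℕ.≤-trans i<a (ℕ.m≤n+m a t)))
                         (cong (a ℕ.+_) (ℕ.+-∸-assoc t i<a)))

module BinomialSums where
  open Sums
  open import Defs using (signPow; phi; rhs; sumFromTo)
  open import Data.Nat as ℕ using (ℕ; zero; suc; _∸_; _≤_; _<_; _≥_; z≤n; s≤s)
  import Data.Nat.Properties as ℕ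
  import Data.Nat.Tactic.RingSolver as ℕ-Solver
  open import Data.Nat.Combinatorics using (_C_; nCk+nC[k+1]≡[n+1]C[k+1]; k>n⇒nCk≡0)
  open import Data.Integer using (ℤ; +_; -_; _+_; _*_; _-_; 0ℤ; 1ℤ)
  import Data.Integer.Properties as ℤ
  open import Data.Integer.Tactic.RingSolver using (solve-∀)
  open import Data.Product using (_,_)
  open import Relation.Binary.PropositionalEquality
    using (_≡_; refl; sym; trans; cong; cong₂; subst; module ≡-Reasoning)
  open ≡-Reasoning

  +-pascal : ∀ n k → + (suc n C suc k) ≡ + (n C suc k) + + (n C k)
  +-pascal n k = begin
    + (suc n C suc k)         ≡⟨ cong +_ (nCk+nC[k+1]≡[n+1]C[k+1] n k) ⟨
    + (n C k ℕ.+ n C suc k)   ≡⟨ ℤ.pos-+ (n C k) (n C suc k) ⟩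
    + (n C k) + + (n C suc k) ≡⟨ ℤ.+-comm (+ (n C k)) (+ (n C suc k)) ⟩
    + (n C suc k) + + (n C k) ∎

  convolution : (ℕ → ℤ) → ℕ → ℕ → ℤ
  convolution w s m = ∑ (suc m) (λ j → w j * + ((m ∸ j) C s))

  convolution-pascal : ∀ w s m →
    convolution w (suc s) (suc m) ≡ convolution w (suc s) m + convolution w s m
  convolution-pascal w s m = begin
    ∑ (suc m) (λ j → w j * + ((suc m ∸ j) C suc s)) + w (suc m) * + ((m ∸ m) C suc s)
      ≡⟨ cong₂ _+_ (∑-cong (suc m) split)
                   (cong (λ k → w (suc m) * + (k C suc s)) (ℕ.n∸n≡0 m)) ⟩
    ∑ (suc m) (λ j → w j * + ((m ∸ j) C suc s) + w j * + ((m ∸ j) C s)) + w (suc m) * 0ℤ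
      ≡⟨ cong₂ _+_ (∑-+ (suc m) _ _) (ℤ.*-zeroʳ (w (suc m))) ⟩
    convolution w (suc s) m + convolution w s m + 0ℤ
      ≡⟨ ℤ.+-identityʳ _ ⟩
    convolution w (suc s) m + convolution w s m ∎
    where
    split : ∀ j → j < suc m →
            w j * + ((suc m ∸ j) C suc s) ≡ w j * + ((m ∸ j) C suc s) + w j * + ((m ∸ j) C s)
    split j (s≤s j≤m) = begin
      w j * + ((suc m ∸ j) C suc s)
        ≡⟨ cong (λ k → w j * + (k C suc s)) (ℕ.+-∸-assoc 1 j≤m) ⟩
      w j * + (suc (m ∸ j) C suc s)
        ≡⟨ cong (w j *_) (+-pascal (m ∸ j) s) ⟩
      w j * (+ ((m ∸ j) C suc s) + + ((m ∸ j) C s))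
        ≡⟨ ℤ.*-distribˡ-+ (w j) _ _ ⟩
      w j * + ((m ∸ j) C suc s) + w j * + ((m ∸ j) C s) ∎

  ∑-C-hockeyStick : ∀ r m → ∑ (suc m) (λ j → + (j C r)) ≡ + (suc m C suc r)
  ∑-C-hockeyStick r zero    =
    cong +_ (trans (sym (ℕ.+-identityʳ (0 C r))) (nCk+nC[k+1]≡[n+1]C[k+1] 0 r))
  ∑-C-hockeyStick r (suc m) = begin
    ∑ (suc m) (λ j → + (j C r)) + + (suc m C r)
      ≡⟨ cong (_+ + (suc m C r)) (∑-C-hockeyStick r m) ⟩
    + (suc m C suc r) + + (suc m C r)
      ≡⟨ +-pascal (suc m) r ⟨
    + (suc (suc m) C suc r) ∎

  vandermonde : ∀ r s m → convolution (λ j → + (j C r)) s m ≡ + (suc m C suc (r ℕ.+ s))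
  vandermonde r zero    m = begin
    convolution (λ j → + (j C r)) 0 m
      ≡⟨ ∑-cong (suc m) (λ j _ → ℤ.*-identityʳ (+ (j C r))) ⟩
    ∑ (suc m) (λ j → + (j C r))
      ≡⟨ ∑-C-hockeyStick r m ⟩
    + (suc m C suc r)
      ≡⟨ cong (λ k → + (suc m C suc k)) (ℕ.+-identityʳ r) ⟨
    + (suc m C suc (r ℕ.+ 0)) ∎
  vandermonde r (suc s) zero    = begin
    0ℤ + + (0 C r) * + 0
      ≡⟨ trans (ℤ.+-identityˡ _) (ℤ.*-zeroʳ (+ (0 C r))) ⟩
    0ℤ
      ≡⟨ cong +_ (k>n⇒nCk≡0 (s≤s (ℕ.≤-trans (s≤s z≤n) (ℕ.m≤n+m (suc s) r)))) ⟨
    + (1 C suc (r ℕ.+ suc s)) ∎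
  vandermonde r (suc s) (suc m) = begin
    convolution (λ j → + (j C r)) (suc s) (suc m)
      ≡⟨ convolution-pascal (λ j → + (j C r)) s m ⟩
    convolution (λ j → + (j C r)) (suc s) m + convolution (λ j → + (j C r)) s m
      ≡⟨ cong₂ _+_ (vandermonde r (suc s) m) (vandermonde r s m) ⟩
    + (suc m C suc (r ℕ.+ suc s)) + + (suc m C suc (r ℕ.+ s))
      ≡⟨ cong (λ k → + (suc m C suc k) + + (suc m C suc (r ℕ.+ s))) (ℕ.+-suc r s) ⟩
    + (suc m C suc (suc (r ℕ.+ s))) + + (suc m C suc (r ℕ.+ s))
      ≡⟨ +-pascal (suc m) (suc (r ℕ.+ s)) ⟨
    + (suc (suc m) C suc (suc (r ℕ.+ s)))
      ≡⟨ cong (λ k → + (suc (suc m) C suc k)) (ℕ.+-suc r s) ⟨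
    + (suc (suc m) C suc (r ℕ.+ suc s)) ∎

  alternating : ℕ → ℕ → ℕ → ℤ
  alternating r = convolution (λ j → signPow j * + (j C r))

  alternating-suc : ∀ r s m →
    alternating (suc r) s (suc m) ≡ - (alternating (suc r) s m + alternating r s m)
  alternating-suc r s m = begin
    alternating (suc r) s (suc m)
      ≡⟨ ∑-suc (suc m) _ ⟩
    + 0 * + (suc m C s) + ∑ (suc m) (λ i → signPow (suc i) * + (suc i C suc r) * + ((m ∸ i) C s))
      ≡⟨ trans (ℤ.+-identityˡ _) (∑-cong (suc m) (λ i _ → pascal-step i)) ⟩
    ∑ (suc m) (λ i → - (term (suc r) i + term r i))
      ≡⟨ trans (∑-neg (suc m) _) (cong -_ (∑-+ (suc m) (term (suc r)) (term r))) ⟩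
    - (alternating (suc r) s m + alternating r s m) ∎
    where
    term : ℕ → ℕ → ℤ
    term k i = signPow i * + (i C k) * + ((m ∸ i) C s)
    expand : ∀ σ a b c → - σ * (a + b) * c ≡ - (σ * a * c + σ * b * c)
    expand = solve-∀
    pascal-step : ∀ i →
      signPow (suc i) * + (suc i C suc r) * + ((m ∸ i) C s) ≡ - (term (suc r) i + term r i)
    pascal-step i = trans (cong (λ x → - signPow i * x * + ((m ∸ i) C s)) (+-pascal i r))
                          (expand (signPow i) _ _ _)

  alternating-suc-suc : ∀ r s m →
    alternating (suc r) (suc s) (suc (suc m)) ≡ alternating (suc r) (suc s) m - alternating r s m
  alternating-suc-suc r s m = begin
    alternating (suc r) (suc s) (suc (suc m))
      ≡⟨ convolution-pascal w s (suc m) ⟩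
    alternating (suc r) (suc s) (suc m) + alternating (suc r) s (suc m)
      ≡⟨ cong₂ _+_ (convolution-pascal w s m) (alternating-suc r s m) ⟩
    alternating (suc r) (suc s) m + alternating (suc r) s m
      + - (alternating (suc r) s m + alternating r s m)
      ≡⟨ cancel (alternating (suc r) (suc s) m) (alternating (suc r) s m) (alternating r s m) ⟩
    alternating (suc r) (suc s) m - alternating r s m ∎
    where
    w = λ j → signPow j * + (j C suc r)
    cancel : ∀ x y z → x + y + - (y + z) ≡ x - z
    cancel = solve-∀

  signPow-even : ∀ k → signPow (2 ℕ.* k) ≡ 1ℤ
  signPow-even zero    = refl
  signPow-even (suc k) =
    trans (cong signPow (ℕ.*-suc 2 k)) (trans (ℤ.neg-involutive _) (signPow-even k))

  ∑-signPow : ∀ k → ∑ (suc (2 ℕ.* k)) signPow ≡ 1ℤ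
  ∑-signPow zero    = refl
  ∑-signPow (suc k) = begin
    ∑ (suc (2 ℕ.* suc k)) signPow     ≡⟨ cong (λ m → ∑ (suc m) signPow) (ℕ.*-suc 2 k) ⟩
    ∑ (suc (2 ℕ.* k)) signPow + σ + - σ ≡⟨ cancel (∑ (suc (2 ℕ.* k)) signPow) σ ⟩
    ∑ (suc (2 ℕ.* k)) signPow         ≡⟨ ∑-signPow k ⟩
    1ℤ                                ∎
    where
    σ = signPow (suc (2 ℕ.* k))
    cancel : ∀ x y → x + y + - y ≡ x
    cancel = solve-∀

  alternating-diagonal : ∀ r k → alternating r r (2 ℕ.* k) ≡ signPow r * + (k C r)
  alternating-diagonal zero    k = begin
    ∑ (suc (2 ℕ.* k)) (λ j → signPow j * 1ℤ * 1ℤ)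
      ≡⟨ ∑-cong (suc (2 ℕ.* k)) (λ j _ → ℤ.*-identityʳ (signPow j * 1ℤ)) ⟩
    ∑ (suc (2 ℕ.* k)) (λ j → signPow j * 1ℤ)
      ≡⟨ ∑-cong (suc (2 ℕ.* k)) (λ j _ → ℤ.*-identityʳ (signPow j)) ⟩
    ∑ (suc (2 ℕ.* k)) signPow
      ≡⟨ ∑-signPow k ⟩
    1ℤ ∎
  alternating-diagonal (suc r) zero    = sym (ℤ.*-zeroʳ (signPow (suc r)))
  alternating-diagonal (suc r) (suc k) = begin
    alternating (suc r) (suc r) (2 ℕ.* suc k)
      ≡⟨ cong (alternating (suc r) (suc r)) (ℕ.*-suc 2 k) ⟩
    alternating (suc r) (suc r) (suc (suc (2 ℕ.* k)))
      ≡⟨ alternating-suc-suc r r (2 ℕ.* k) ⟩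
    alternating (suc r) (suc r) (2 ℕ.* k) - alternating r r (2 ℕ.* k)
      ≡⟨ cong₂ _-_ (alternating-diagonal (suc r) k) (alternating-diagonal r k) ⟩
    - signPow r * + (k C suc r) - signPow r * + (k C r)
      ≡⟨ regroup (signPow r) (+ (k C suc r)) (+ (k C r)) ⟩
    - signPow r * (+ (k C suc r) + + (k C r))
      ≡⟨ cong (λ x → - signPow r * x) (+-pascal k r) ⟨
    - signPow r * + (suc k C suc r) ∎
    where
    regroup : ∀ σ a b → - σ * a - σ * b ≡ - σ * (a + b)
    regroup = solve-∀

  ∑-parity : ∀ k h → ∑ (suc (2 ℕ.* k)) h ≡
    ∑ (suc (2 ℕ.* k)) (λ j → signPow j * h j) + + 2 * ∑ k (λ i → h (suc (2 ℕ.* i)))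
  ∑-parity zero    h = regroup (h 0)
    where
    regroup : ∀ x → 0ℤ + x ≡ 0ℤ + 1ℤ * x + + 2 * 0ℤ
    regroup = solve-∀
  ∑-parity (suc k) h = begin
    ∑ (suc (2 ℕ.* suc k)) h
      ≡⟨ cong (λ m → ∑ (suc m) h) (ℕ.*-suc 2 k) ⟩
    ∑ (suc m) h + h (suc m) + h (suc (suc m))
      ≡⟨ cong (λ x → x + h (suc m) + h (suc (suc m))) (∑-parity k h) ⟩
    E + + 2 * O + h (suc m) + h (suc (suc m))
      ≡⟨ regroup E O (h (suc m)) (h (suc (suc m))) ⟩
    E + - 1ℤ * h (suc m) + - - 1ℤ * h (suc (suc m)) + + 2 * (O + h (suc m))
      ≡⟨ cong (λ σ → E + - σ * h (suc m) + - - σ * h (suc (suc m)) + + 2 * (O + h (suc m)))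
              (signPow-even k) ⟨
    ∑ (suc (suc (suc m))) (λ j → signPow j * h j) + + 2 * O′
      ≡⟨ cong (λ n → ∑ (suc n) (λ j → signPow j * h j) + + 2 * O′) (ℕ.*-suc 2 k) ⟨
    ∑ (suc (2 ℕ.* suc k)) (λ j → signPow j * h j) + + 2 * O′ ∎
    where
    m = 2 ℕ.* k
    E = ∑ (suc m) (λ j → signPow j * h j)
    O = ∑ k (λ i → h (suc (2 ℕ.* i)))
    O′ = ∑ (suc k) (λ i → h (suc (2 ℕ.* i)))
    regroup : ∀ e o x y → e + + 2 * o + x + y ≡ e + - 1ℤ * x + - - 1ℤ * y + + 2 * (o + x)
    regroup = solve-∀

  summand : ℕ → ℕ → ℕ → ℕ
  summand r n k = ((2 ℕ.* k ∸ 1) C r) ℕ.* ((2 ℕ.* n ∸ 2 ℕ.* k ∸ 1) C r)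

  summand-reflect : ∀ r {n k} → k ≤ n → summand r n (n ∸ k) ≡ summand r n k
  summand-reflect r {n} {k} k≤n = begin
    ((2 ℕ.* (n ∸ k) ∸ 1) C r) ℕ.* ((2 ℕ.* n ∸ 2 ℕ.* (n ∸ k) ∸ 1) C r)
      ≡⟨ cong (λ d → ((d ∸ 1) C r) ℕ.* ((2 ℕ.* n ∸ d ∸ 1) C r)) (ℕ.*-distribˡ-∸ 2 n k) ⟩
    ((2 ℕ.* n ∸ 2 ℕ.* k ∸ 1) C r) ℕ.* ((2 ℕ.* n ∸ (2 ℕ.* n ∸ 2 ℕ.* k) ∸ 1) C r)
      ≡⟨ cong (λ d → ((2 ℕ.* n ∸ 2 ℕ.* k ∸ 1) C r) ℕ.* ((d ∸ 1) C r))
              (ℕ.m∸[m∸n]≡n (ℕ.*-monoʳ-≤ 2 k≤n)) ⟩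
    ((2 ℕ.* n ∸ 2 ℕ.* k ∸ 1) C r) ℕ.* ((2 ℕ.* k ∸ 1) C r)
      ≡⟨ ℕ.*-comm ((2 ℕ.* n ∸ 2 ℕ.* k ∸ 1) C r) ((2 ℕ.* k ∸ 1) C r) ⟩
    summand r n k ∎

  2[1+m]∸2[1+n]∸1≡2m∸[1+2n] : ∀ m n →
    2 ℕ.* suc m ∸ 2 ℕ.* suc n ∸ 1 ≡ 2 ℕ.* m ∸ suc (2 ℕ.* n)
  2[1+m]∸2[1+n]∸1≡2m∸[1+2n] m n = begin
    2 ℕ.* suc m ∸ 2 ℕ.* suc n ∸ 1 ≡⟨ cong₂ (λ a b → a ∸ b ∸ 1) (ℕ.*-suc 2 m) (ℕ.*-suc 2 n) ⟩
    2 ℕ.* m ∸ 2 ℕ.* n ∸ 1         ≡⟨ ℕ.∸-+-assoc (2 ℕ.* m) (2 ℕ.* n) 1 ⟩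
    2 ℕ.* m ∸ (2 ℕ.* n ℕ.+ 1)     ≡⟨ cong (2 ℕ.* m ∸_) (ℕ.+-comm (2 ℕ.* n) 1) ⟩
    2 ℕ.* m ∸ suc (2 ℕ.* n)       ∎

  binomial-parity-split : ∀ r p → + ((2 ℕ.* suc p ∸ 1) C (2 ℕ.* r ℕ.+ 1)) ≡
    signPow r * + (p C r) + + 2 * ∑ p (λ i → + summand r (suc p) (suc i))
  binomial-parity-split r p = begin
    + ((2 ℕ.* suc p ∸ 1) C (2 ℕ.* r ℕ.+ 1))
      ≡⟨ cong₂ (λ a b → + ((a ∸ 1) C b)) (ℕ.*-suc 2 p) (2r+1≡1+[r+r] r) ⟩
    + (suc (2 ℕ.* p) C suc (r ℕ.+ r))
      ≡⟨ vandermonde r r (2 ℕ.* p) ⟨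
    ∑ (suc (2 ℕ.* p)) h
      ≡⟨ ∑-parity p h ⟩
    ∑ (suc (2 ℕ.* p)) (λ j → signPow j * h j) + + 2 * ∑ p (λ i → h (suc (2 ℕ.* i)))
      ≡⟨ cong₂ (λ a o → a + + 2 * o)
               (trans (∑-cong (suc (2 ℕ.* p)) (λ j _ → sym (ℤ.*-assoc (signPow j) (+ (j C r)) _)))
                      (alternating-diagonal r p))
               (∑-cong p (λ i _ → odd i)) ⟩
    signPow r * + (p C r) + + 2 * ∑ p (λ i → + summand r (suc p) (suc i)) ∎
    where
    2r+1≡1+[r+r] : ∀ r → 2 ℕ.* r ℕ.+ 1 ≡ suc (r ℕ.+ r)
    2r+1≡1+[r+r] = ℕ-Solver.solve-∀
    h : ℕ → ℤ
    h j = + (j C r) * + ((2 ℕ.* p ∸ j) C r)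
    odd : ∀ i → h (suc (2 ℕ.* i)) ≡ + summand r (suc p) (suc i)
    odd i = begin
      + (suc (2 ℕ.* i) C r) * + ((2 ℕ.* p ∸ suc (2 ℕ.* i)) C r)
        ≡⟨ cong₂ (λ a b → + (a C r) * + (b C r)) (cong (_∸ 1) (ℕ.*-suc 2 i))
                                                (2[1+m]∸2[1+n]∸1≡2m∸[1+2n] p i) ⟨
      + ((2 ℕ.* suc i ∸ 1) C r) * + ((2 ℕ.* suc p ∸ 2 ℕ.* suc i ∸ 1) C r)
        ≡⟨ ℤ.pos-* ((2 ℕ.* suc i ∸ 1) C r) ((2 ℕ.* suc p ∸ 2 ℕ.* suc i ∸ 1) C r) ⟨
      + summand r (suc p) (suc i) ∎

  -- For n = 1 + r + t + r the summation range 1 ≤ k ≤ n - 1 splits into blocks of r, t and r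
  -- terms, the middle one being the sum in phi.
  phi≡rhs-balanced : ∀ r t → phi r (suc (r ℕ.+ (t ℕ.+ r))) ≡ rhs r (suc (r ℕ.+ (t ℕ.+ r)))
  phi≡rhs-balanced r t = begin
    phi r (suc p)
      ≡⟨ cong₂ _-_ (binomial-parity-split r p) middle ⟩
    σ + + 2 * ∑ p Q - + 2 * M
      ≡⟨ cong (λ x → σ + + 2 * x - + 2 * M) (∑-palindrome r t Q palindromic) ⟩
    σ + + 2 * (+ 2 * ∑ r Q + M) - + 2 * M
      ≡⟨ cancel σ (∑ r Q) M ⟩
    σ + + 4 * ∑ r Q
      ≡⟨ cong (λ x → σ + x) (trans (ℤ.pos-* 4 (sumFromTo 1 r F))
                                  (cong (+ 4 *_) (+sumFromTo-suc 0 r F))) ⟨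
    rhs r (suc p) ∎
    where
    p = r ℕ.+ (t ℕ.+ r)
    σ = signPow r * + (p C r)
    F = summand r (suc p)
    Q : ℕ → ℤ
    Q i = + F (suc i)
    M = ∑ t (λ i → Q (r ℕ.+ i))
    cancel : ∀ a x y → a + + 2 * (+ 2 * x + y) - + 2 * y ≡ a + + 4 * x
    cancel = solve-∀
    palindromic : ∀ i → i < p → Q (p ∸ suc i) ≡ Q i
    palindromic i i<p = cong +_ (trans (cong F (sym (ℕ.+-∸-assoc 1 i<p)))
                                       (summand-reflect r (s≤s (ℕ.<⇒≤ i<p))))
    upper : suc p ∸ r ∸ 1 ≡ r ℕ.+ t
    upper = begin
      suc p ∸ r ∸ 1                 ≡⟨ cong (λ x → x ∸ r ∸ 1) (ℕ.+-suc r (t ℕ.+ r)) ⟨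
      r ℕ.+ suc (t ℕ.+ r) ∸ r ∸ 1   ≡⟨ cong (_∸ 1) (ℕ.m+n∸m≡n r (suc (t ℕ.+ r))) ⟩
      t ℕ.+ r                       ≡⟨ ℕ.+-comm t r ⟩
      r ℕ.+ t                       ∎
    middle : + (2 ℕ.* sumFromTo (r ℕ.+ 1) (suc p ∸ r ∸ 1) F) ≡ + 2 * M
    middle = begin
      + (2 ℕ.* sumFromTo (r ℕ.+ 1) (suc p ∸ r ∸ 1) F)
        ≡⟨ ℤ.pos-* 2 (sumFromTo (r ℕ.+ 1) (suc p ∸ r ∸ 1) F) ⟩
      + 2 * + sumFromTo (r ℕ.+ 1) (suc p ∸ r ∸ 1) F
        ≡⟨ cong₂ (λ a b → + 2 * + sumFromTo a b F) (ℕ.+-comm r 1) upper ⟩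
      + 2 * + sumFromTo (suc r) (r ℕ.+ t) F
        ≡⟨ cong (+ 2 *_) (+sumFromTo-suc r t F) ⟩
      + 2 * M ∎

  phi≡rhs : ∀ r n → n ≥ 2 ℕ.* r ℕ.+ 1 → phi r n ≡ rhs r n
  phi≡rhs r n n≥ with ℕ.m≤n⇒∃[o]m+o≡n n≥
  ... | t , refl = subst (λ n → phi r n ≡ rhs r n) (balanced r t) (phi≡rhs-balanced r t)
    where
    balanced : ∀ r t → suc (r ℕ.+ (t ℕ.+ r)) ≡ 2 ℕ.* r ℕ.+ 1 ℕ.+ t
    balanced = ℕ-Solver.solve-∀

module Polynomiality where
  open Sums using (∑; +sumFromTo-suc)
  open BinomialSums using (summand)
  open import Defs using (evalPoly; ℤtoℚ; ℕtoℚ; signPow; rhs; sumFromTo)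
  open import Level using (0ℓ)
  open import Data.Nat as ℕ using (ℕ; zero; suc; _∸_; _≤_; _<_; _≥_)
  import Data.Nat.Properties as ℕ
  import Data.Nat.Tactic.RingSolver as ℕ-Solver
  open import Data.Nat.Combinatorics using (_C_; nC1≡n; nCk+nC[k+1]≡[n+1]C[k+1])
  open import Data.Nat.Coprimality using (1-coprimeTo) renaming (sym to coprime-sym)
  open import Data.Integer as ℤ using (ℤ; +_; -[1+_])
  import Data.Integer.Properties as ℤ
  open import Data.Rational as ℚ using (ℚ; mkℚ; 0ℚ; 1ℚ; _+_; _*_; _-_; -_; 1/_)
  import Data.Rational.Properties as ℚ
  open import Data.Vec using (Vec; []; _∷_; map; zipWith; replicate; _∷ʳ_)
  open import Relation.Nullary.Decidable using (dec⇒maybe)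
  open import Tactic.RingSolver using (solve-∀)
  open import Tactic.RingSolver.Core.AlmostCommutativeRing
    using (AlmostCommutativeRing; fromCommutativeRing)
  open import Relation.Binary.PropositionalEquality
    using (_≡_; refl; sym; trans; cong; cong₂; subst; module ≡-Reasoning)
  open ≡-Reasoning

  -- The zero test lets the solver discard monomials with coefficient 0ℚ.
  ℚ-ring : AlmostCommutativeRing 0ℓ 0ℓ
  ℚ-ring = fromCommutativeRing ℚ.+-*-commutativeRing (λ x → dec⇒maybe (0ℚ ℚ.≟ x))

  -- On this normal form with denominator 1 the arithmetic of ℚ computes, which gives the
  -- homomorphism laws below.
  ℤtoℚ≡mkℚ : ∀ z → ℤtoℚ z ≡ mkℚ z 0 (coprime-sym (1-coprimeTo ℤ.∣ z ∣))
  ℤtoℚ≡mkℚ (+ n)    = ℚ.normalize-coprime (coprime-sym (1-coprimeTo n))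
  ℤtoℚ≡mkℚ -[1+ n ] = cong -_ (ℚ.normalize-coprime (coprime-sym (1-coprimeTo (suc n))))

  ℤtoℚ-+ : ∀ a b → ℤtoℚ (a ℤ.+ b) ≡ ℤtoℚ a + ℤtoℚ b
  ℤtoℚ-+ a b = begin
    (a ℤ.+ b) ℚ./ 1
      ≡⟨ cong (ℚ._/ 1) (cong₂ ℤ._+_ (ℤ.*-identityʳ a) (ℤ.*-identityʳ b)) ⟨
    (a ℤ.* + 1 ℤ.+ b ℤ.* + 1) ℚ./ 1
      ≡⟨ cong₂ _+_ (ℤtoℚ≡mkℚ a) (ℤtoℚ≡mkℚ b) ⟨
    ℤtoℚ a + ℤtoℚ b ∎

  ℤtoℚ-* : ∀ a b → ℤtoℚ (a ℤ.* b) ≡ ℤtoℚ a * ℤtoℚ b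
  ℤtoℚ-* a b = sym (cong₂ _*_ (ℤtoℚ≡mkℚ a) (ℤtoℚ≡mkℚ b))

  ℕtoℚ-+ : ∀ m n → ℕtoℚ (m ℕ.+ n) ≡ ℕtoℚ m + ℕtoℚ n
  ℕtoℚ-+ m n = trans (cong ℤtoℚ (ℤ.pos-+ m n)) (ℤtoℚ-+ (+ m) (+ n))

  ℕtoℚ-* : ∀ m n → ℕtoℚ (m ℕ.* n) ≡ ℕtoℚ m * ℕtoℚ n
  ℕtoℚ-* m n = trans (cong ℤtoℚ (ℤ.pos-* m n)) (ℤtoℚ-* (+ m) (+ n))

  ℕtoℚ-suc-nonZero : ∀ n → ℚ.NonZero (ℕtoℚ (suc n))
  ℕtoℚ-suc-nonZero n = subst ℚ.NonZero (sym (ℤtoℚ≡mkℚ (+ suc n))) _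

  1/[1+_] : ℕ → ℚ
  1/[1+ n ] = (1/ ℕtoℚ (suc n)) {{ℕtoℚ-suc-nonZero n}}

  1/[1+n]*[1+n]≡1 : ∀ n → 1/[1+ n ] * ℕtoℚ (suc n) ≡ 1ℚ
  1/[1+n]*[1+n]≡1 n = ℚ.*-inverseˡ (ℕtoℚ (suc n)) {{ℕtoℚ-suc-nonZero n}}

  evalPoly-replicate-0 : ∀ d x → evalPoly (replicate d 0ℚ) x ≡ 0ℚ
  evalPoly-replicate-0 zero    x = refl
  evalPoly-replicate-0 (suc d) x =
    trans (cong (λ e → 0ℚ + x * e) (evalPoly-replicate-0 d x)) (vanish x)
    where
    vanish : ∀ x → 0ℚ + x * 0ℚ ≡ 0ℚ
    vanish = solve-∀ ℚ-ring

  evalPoly-zipWith-+ : ∀ {d} (p q : Vec ℚ d) x →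
    evalPoly (zipWith _+_ p q) x ≡ evalPoly p x + evalPoly q x
  evalPoly-zipWith-+ []      []      x = sym (ℚ.+-identityʳ 0ℚ)
  evalPoly-zipWith-+ (a ∷ p) (b ∷ q) x =
    trans (cong (λ e → a + b + x * e) (evalPoly-zipWith-+ p q x))
          (regroup a b x (evalPoly p x) (evalPoly q x))
    where
    regroup : ∀ a b x e f → a + b + x * (e + f) ≡ a + x * e + (b + x * f)
    regroup = solve-∀ ℚ-ring

  evalPoly-map-* : ∀ {d} c (p : Vec ℚ d) x → evalPoly (map (c *_) p) x ≡ c * evalPoly p x
  evalPoly-map-* c []      x = sym (ℚ.*-zeroʳ c)
  evalPoly-map-* c (a ∷ p) x =
    trans (cong (λ e → c * a + x * e) (evalPoly-map-* c p x)) (regroup c a x (evalPoly p x))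
    where
    regroup : ∀ c a x e → c * a + x * (c * e) ≡ c * (a + x * e)
    regroup = solve-∀ ℚ-ring

  evalPoly-∷ʳ-0 : ∀ {d} (p : Vec ℚ d) x → evalPoly (p ∷ʳ 0ℚ) x ≡ evalPoly p x
  evalPoly-∷ʳ-0 []      x = evalPoly-replicate-0 1 x
  evalPoly-∷ʳ-0 (a ∷ p) x = cong (λ e → a + x * e) (evalPoly-∷ʳ-0 p x)

  linearMul : ∀ {d} → ℚ → ℚ → Vec ℚ d → Vec ℚ (suc d)
  linearMul u v p = zipWith _+_ (map (u *_) (p ∷ʳ 0ℚ)) (0ℚ ∷ map (v *_) p)

  evalPoly-linearMul : ∀ {d} u v (p : Vec ℚ d) x →
    evalPoly (linearMul u v p) x ≡ (u + v * x) * evalPoly p x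
  evalPoly-linearMul u v p x = begin
    evalPoly (linearMul u v p) x
      ≡⟨ evalPoly-zipWith-+ (map (u *_) (p ∷ʳ 0ℚ)) (0ℚ ∷ map (v *_) p) x ⟩
    evalPoly (map (u *_) (p ∷ʳ 0ℚ)) x + (0ℚ + x * evalPoly (map (v *_) p) x)
      ≡⟨ cong₂ (λ e f → e + (0ℚ + x * f))
               (trans (evalPoly-map-* u (p ∷ʳ 0ℚ) x) (cong (u *_) (evalPoly-∷ʳ-0 p x)))
               (evalPoly-map-* v p x) ⟩
    u * evalPoly p x + (0ℚ + x * (v * evalPoly p x))
      ≡⟨ regroup u v x (evalPoly p x) ⟩
    (u + v * x) * evalPoly p x ∎
    where
    regroup : ∀ u v x e → u * e + (0ℚ + x * (v * e)) ≡ (u + v * x) * e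
    regroup = solve-∀ ℚ-ring

  [1+k]*nC[1+k]+k*nCk≡n*nCk : ∀ n k →
    suc k ℕ.* (n C suc k) ℕ.+ k ℕ.* (n C k) ≡ n ℕ.* (n C k)
  [1+k]*nC[1+k]+k*nCk≡n*nCk n zero = begin
    1 ℕ.* (n C 1) ℕ.+ 0 ℕ.* 1 ≡⟨ unit (n C 1) ⟩
    n C 1                     ≡⟨ nC1≡n n ⟩
    n                         ≡⟨ ℕ.*-identityʳ n ⟨
    n ℕ.* 1                   ∎
    where
    unit : ∀ c → 1 ℕ.* c ℕ.+ 0 ℕ.* 1 ≡ c
    unit = ℕ-Solver.solve-∀
  [1+k]*nC[1+k]+k*nCk≡n*nCk zero    (suc k) = vanish k
    where
    vanish : ∀ k → suc (suc k) ℕ.* 0 ℕ.+ suc k ℕ.* 0 ≡ 0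
    vanish = ℕ-Solver.solve-∀
  [1+k]*nC[1+k]+k*nCk≡n*nCk (suc n) (suc k) = begin
    suc (suc k) ℕ.* (suc n C suc (suc k)) ℕ.+ suc k ℕ.* (suc n C suc k)
      ≡⟨ cong₂ (λ a b → suc (suc k) ℕ.* a ℕ.+ suc k ℕ.* b)
               (sym (nCk+nC[k+1]≡[n+1]C[k+1] n (suc k))) (sym (nCk+nC[k+1]≡[n+1]C[k+1] n k)) ⟩
    suc (suc k) ℕ.* (c₁ ℕ.+ c₂) ℕ.+ suc k ℕ.* (c₀ ℕ.+ c₁)
      ≡⟨ regroup k c₀ c₁ c₂ ⟩
    (suc (suc k) ℕ.* c₂ ℕ.+ suc k ℕ.* c₁) ℕ.+ (suc k ℕ.* c₁ ℕ.+ k ℕ.* c₀)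
      ℕ.+ (c₀ ℕ.+ c₁)
      ≡⟨ cong₂ (λ a b → a ℕ.+ b ℕ.+ (c₀ ℕ.+ c₁))
               ([1+k]*nC[1+k]+k*nCk≡n*nCk n (suc k)) ([1+k]*nC[1+k]+k*nCk≡n*nCk n k) ⟩
    n ℕ.* c₁ ℕ.+ n ℕ.* c₀ ℕ.+ (c₀ ℕ.+ c₁)
      ≡⟨ factor n c₀ c₁ ⟩
    suc n ℕ.* (c₀ ℕ.+ c₁)
      ≡⟨ cong (suc n ℕ.*_) (nCk+nC[k+1]≡[n+1]C[k+1] n k) ⟩
    suc n ℕ.* (suc n C suc k) ∎
    where
    c₀ = n C k
    c₁ = n C suc k
    c₂ = n C suc (suc k)
    regroup : ∀ k c₀ c₁ c₂ →
      suc (suc k) ℕ.* (c₁ ℕ.+ c₂) ℕ.+ suc k ℕ.* (c₀ ℕ.+ c₁) ≡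
      (suc (suc k) ℕ.* c₂ ℕ.+ suc k ℕ.* c₁) ℕ.+ (suc k ℕ.* c₁ ℕ.+ k ℕ.* c₀) ℕ.+ (c₀ ℕ.+ c₁)
    regroup = ℕ-Solver.solve-∀
    factor : ∀ n c₀ c₁ →
      n ℕ.* c₁ ℕ.+ n ℕ.* c₀ ℕ.+ (c₀ ℕ.+ c₁) ≡ suc n ℕ.* (c₀ ℕ.+ c₁)
    factor = ℕ-Solver.solve-∀

  [1+k]*nC[1+k]≡[n-k]*nCk : ∀ n k →
    ℕtoℚ (suc k) * ℕtoℚ (n C suc k) ≡ (ℕtoℚ n - ℕtoℚ k) * ℕtoℚ (n C k)
  [1+k]*nC[1+k]≡[n-k]*nCk n k = begin
    ℕtoℚ (suc k) * c₁
      ≡⟨ shift (ℕtoℚ (suc k) * c₁) (ℕtoℚ k * c₀) ⟩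
    ℕtoℚ (suc k) * c₁ + ℕtoℚ k * c₀ - ℕtoℚ k * c₀
      ≡⟨ cong (_- ℕtoℚ k * c₀) lifted ⟩
    ℕtoℚ n * c₀ - ℕtoℚ k * c₀
      ≡⟨ factor (ℕtoℚ n) (ℕtoℚ k) c₀ ⟩
    (ℕtoℚ n - ℕtoℚ k) * c₀ ∎
    where
    c₀ = ℕtoℚ (n C k)
    c₁ = ℕtoℚ (n C suc k)
    shift : ∀ a b → a ≡ a + b - b
    shift = solve-∀ ℚ-ring
    factor : ∀ n k c → n * c - k * c ≡ (n - k) * c
    factor = solve-∀ ℚ-ring
    lifted : ℕtoℚ (suc k) * c₁ + ℕtoℚ k * c₀ ≡ ℕtoℚ n * c₀
    lifted = begin
      ℕtoℚ (suc k) * c₁ + ℕtoℚ k * c₀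
        ≡⟨ cong₂ _+_ (ℕtoℚ-* (suc k) (n C suc k)) (ℕtoℚ-* k (n C k)) ⟨
      ℕtoℚ (suc k ℕ.* (n C suc k)) + ℕtoℚ (k ℕ.* (n C k))
        ≡⟨ ℕtoℚ-+ (suc k ℕ.* (n C suc k)) (k ℕ.* (n C k)) ⟨
      ℕtoℚ (suc k ℕ.* (n C suc k) ℕ.+ k ℕ.* (n C k))
        ≡⟨ cong ℕtoℚ ([1+k]*nC[1+k]+k*nCk≡n*nCk n k) ⟩
      ℕtoℚ (n ℕ.* (n C k))
        ≡⟨ ℕtoℚ-* n (n C k) ⟩
      ℕtoℚ n * c₀ ∎

  binomialPoly : ℚ → ℚ → (j : ℕ) → Vec ℚ (suc j)
  binomialPoly u v zero    = 1ℚ ∷ []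
  binomialPoly u v (suc j) = map (1/[1+ j ] *_) (linearMul (u - ℕtoℚ j) v (binomialPoly u v j))

  evalPoly-binomialPoly : ∀ u v x n → u + v * x ≡ ℕtoℚ n →
                          ∀ j → evalPoly (binomialPoly u v j) x ≡ ℕtoℚ (n C j)
  evalPoly-binomialPoly u v x n u+vx≡n zero    = constant x
    where
    constant : ∀ x → 1ℚ + x * 0ℚ ≡ 1ℚ
    constant = solve-∀ ℚ-ring
  evalPoly-binomialPoly u v x n u+vx≡n (suc j) = begin
    evalPoly (map (ι *_) (linearMul (u - ℕtoℚ j) v (binomialPoly u v j))) x
      ≡⟨ evalPoly-map-* ι (linearMul (u - ℕtoℚ j) v (binomialPoly u v j)) x ⟩
    ι * evalPoly (linearMul (u - ℕtoℚ j) v (binomialPoly u v j)) x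
      ≡⟨ cong (ι *_) (evalPoly-linearMul (u - ℕtoℚ j) v (binomialPoly u v j) x) ⟩
    ι * ((u - ℕtoℚ j + v * x) * evalPoly (binomialPoly u v j) x)
      ≡⟨ cong₂ (λ a b → ι * (a * b))
               (trans (regroup u v x (ℕtoℚ j)) (cong (_- ℕtoℚ j) u+vx≡n))
               (evalPoly-binomialPoly u v x n u+vx≡n j) ⟩
    ι * ((ℕtoℚ n - ℕtoℚ j) * ℕtoℚ (n C j))
      ≡⟨ cong (ι *_) ([1+k]*nC[1+k]≡[n-k]*nCk n j) ⟨
    ι * (ℕtoℚ (suc j) * ℕtoℚ (n C suc j))
      ≡⟨ ℚ.*-assoc ι (ℕtoℚ (suc j)) (ℕtoℚ (n C suc j)) ⟨
    ι * ℕtoℚ (suc j) * ℕtoℚ (n C suc j)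
      ≡⟨ cong (_* ℕtoℚ (n C suc j)) (1/[1+n]*[1+n]≡1 j) ⟩
    1ℚ * ℕtoℚ (n C suc j)
      ≡⟨ ℚ.*-identityˡ (ℕtoℚ (n C suc j)) ⟩
    ℕtoℚ (n C suc j) ∎
    where
    ι = 1/[1+ j ]
    regroup : ∀ u v x k → u - k + v * x ≡ u + v * x - k
    regroup = solve-∀ ℚ-ring

  record PolynomialOn (P : ℕ → Set) (d : ℕ) (f : ℕ → ℤ) : Set where
    constructor _,_
    field
      coefficients : Vec ℚ (suc d)
      agrees       : ∀ n → P n → ℤtoℚ (f n) ≡ evalPoly coefficients (ℕtoℚ n)

  module _ {P : ℕ → Set} {d : ℕ} where

    PolynomialOn-resp : ∀ {Q f g} → (∀ n → P n → Q n) → (∀ n → P n → f n ≡ g n) →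
                        PolynomialOn Q d g → PolynomialOn P d f
    PolynomialOn-resp P⇒Q f≗g (c , g≡c) =
      c , λ n Pn → trans (cong ℤtoℚ (f≗g n Pn)) (g≡c n (P⇒Q n Pn))

    PolynomialOn-+ : ∀ {f g} → PolynomialOn P d f → PolynomialOn P d g →
                     PolynomialOn P d (λ n → f n ℤ.+ g n)
    PolynomialOn-+ {f} {g} (c , f≡c) (e , g≡e) = zipWith _+_ c e , λ n Pn → begin
      ℤtoℚ (f n ℤ.+ g n)                        ≡⟨ ℤtoℚ-+ (f n) (g n) ⟩
      ℤtoℚ (f n) + ℤtoℚ (g n)                   ≡⟨ cong₂ _+_ (f≡c n Pn) (g≡e n Pn) ⟩
      evalPoly c (ℕtoℚ n) + evalPoly e (ℕtoℚ n) ≡⟨ evalPoly-zipWith-+ c e (ℕtoℚ n) ⟨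
      evalPoly (zipWith _+_ c e) (ℕtoℚ n)       ∎

    PolynomialOn-* : ∀ z {f} → PolynomialOn P d f → PolynomialOn P d (λ n → z ℤ.* f n)
    PolynomialOn-* z {f} (c , f≡c) = map (ℤtoℚ z *_) c , λ n Pn → begin
      ℤtoℚ (z ℤ.* f n)                      ≡⟨ ℤtoℚ-* z (f n) ⟩
      ℤtoℚ z * ℤtoℚ (f n)                   ≡⟨ cong (ℤtoℚ z *_) (f≡c n Pn) ⟩
      ℤtoℚ z * evalPoly c (ℕtoℚ n)          ≡⟨ evalPoly-map-* (ℤtoℚ z) c (ℕtoℚ n) ⟨
      evalPoly (map (ℤtoℚ z *_) c) (ℕtoℚ n) ∎

    PolynomialOn-∑ : ∀ m {f : ℕ → ℕ → ℤ} → (∀ i → i < m → PolynomialOn P d (f i)) →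
                     PolynomialOn P d (λ n → ∑ m (λ i → f i n))
    PolynomialOn-∑ zero    f-poly =
      replicate (suc d) 0ℚ , λ n _ → sym (evalPoly-replicate-0 (suc d) (ℕtoℚ n))
    PolynomialOn-∑ (suc m) f-poly =
      PolynomialOn-+ (PolynomialOn-∑ m (λ i i<m → f-poly i (ℕ.m<n⇒m<1+n i<m))) (f-poly m ℕ.≤-refl)

  binomial-polynomialOn : ∀ a c j →
    PolynomialOn (λ n → c ≤ a ℕ.* n) j (λ n → + ((a ℕ.* n ∸ c) C j))
  binomial-polynomialOn a c j = binomialPoly (- ℕtoℚ c) (ℕtoℚ a) j , λ n c≤an →
    sym (evalPoly-binomialPoly (- ℕtoℚ c) (ℕtoℚ a) (ℕtoℚ n) (a ℕ.* n ∸ c) (linear n c≤an) j)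
    where
    cancel : ∀ x y → - y + (x + y) ≡ x
    cancel = solve-∀ ℚ-ring
    linear : ∀ n → c ≤ a ℕ.* n → - ℕtoℚ c + ℕtoℚ a * ℕtoℚ n ≡ ℕtoℚ (a ℕ.* n ∸ c)
    linear n c≤an = begin
      - ℕtoℚ c + ℕtoℚ a * ℕtoℚ n
        ≡⟨ cong (λ q → - ℕtoℚ c + q) (ℕtoℚ-* a n) ⟨
      - ℕtoℚ c + ℕtoℚ (a ℕ.* n)
        ≡⟨ cong (λ m → - ℕtoℚ c + ℕtoℚ m) (ℕ.m∸n+n≡m c≤an) ⟨
      - ℕtoℚ c + ℕtoℚ (a ℕ.* n ∸ c ℕ.+ c)
        ≡⟨ cong (λ q → - ℕtoℚ c + q) (ℕtoℚ-+ (a ℕ.* n ∸ c) c) ⟩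
      - ℕtoℚ c + (ℕtoℚ (a ℕ.* n ∸ c) + ℕtoℚ c)
        ≡⟨ cancel (ℕtoℚ (a ℕ.* n ∸ c)) (ℕtoℚ c) ⟩
      ℕtoℚ (a ℕ.* n ∸ c) ∎

  rhs-polynomialOn : ∀ r → PolynomialOn (λ n → n ≥ 2 ℕ.* r ℕ.+ 1) r (rhs r)
  rhs-polynomialOn r = PolynomialOn-resp (λ _ n≥ → n≥) (λ n _ → rhs-expanded n)
    (PolynomialOn-+
      (PolynomialOn-* (signPow r) predecessor)
      (PolynomialOn-* (+ 4) (PolynomialOn-∑ r summand-polynomialOn)))
    where
    rhs-expanded : ∀ n →
      rhs r n ≡ signPow r ℤ.* + ((n ∸ 1) C r) ℤ.+ + 4 ℤ.* ∑ r (λ i → + summand r n (suc i))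
    rhs-expanded n = cong (λ z → signPow r ℤ.* + ((n ∸ 1) C r) ℤ.+ z)
      (trans (ℤ.pos-* 4 (sumFromTo 1 r (summand r n)))
             (cong (+ 4 ℤ.*_) (+sumFromTo-suc 0 r (summand r n))))
    predecessor : PolynomialOn (λ n → n ≥ 2 ℕ.* r ℕ.+ 1) r (λ n → + ((n ∸ 1) C r))
    predecessor = PolynomialOn-resp
      (λ n n≥ → ℕ.≤-trans (ℕ.≤-trans (ℕ.m≤n+m 1 (2 ℕ.* r)) n≥) (ℕ.m≤n*m n 1))
      (λ n _ → cong (λ m → + ((m ∸ 1) C r)) (sym (ℕ.*-identityˡ n)))
      (binomial-polynomialOn 1 1 r)
    summand-polynomialOn : ∀ i → i < r →
      PolynomialOn (λ n → n ≥ 2 ℕ.* r ℕ.+ 1) r (λ n → + summand r n (suc i))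
    summand-polynomialOn i i<r = PolynomialOn-resp
      (λ n n≥ → ℕ.≤-trans (ℕ.+-monoˡ-≤ 1 (ℕ.*-monoʳ-≤ 2 i<r))
                          (ℕ.≤-trans n≥ (ℕ.m≤n*m n 2)))
      (λ n _ → trans (ℤ.pos-* a ((2 ℕ.* n ∸ 2 ℕ.* suc i ∸ 1) C r))
                     (cong (λ m → + a ℤ.* + (m C r)) (ℕ.∸-+-assoc (2 ℕ.* n) (2 ℕ.* suc i) 1)))
      (PolynomialOn-* (+ a) (binomial-polynomialOn 2 (2 ℕ.* suc i ℕ.+ 1) r))
      where
      a = (2 ℕ.* suc i ∸ 1) C r

open import Defs
open import Data.Nat using (ℕ; suc; _+_; _*_; _≥_)
open import Data.Vec using (Vec)
open import Data.Rational using (ℚ)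
open import Data.Product using (_×_; Σ; _,_)
open import Relation.Binary.PropositionalEquality using (_≡_)
open BinomialSums using (phi≡rhs)
open Polynomiality using (module PolynomialOn; rhs-polynomialOn)

lemma3p5 : (r : ℕ) →
    ((n : ℕ) → n ≥ 2 * r + 1 → phi r n ≡ rhs r n)
    × Σ (Vec ℚ (suc r)) (λ c →
        (n : ℕ) → n ≥ 2 * r + 1 → ℤtoℚ (rhs r n) ≡ evalPoly c (ℕtoℚ n))
lemma3p5 r = phi≡rhs r , (coefficients , agrees)
  where open PolynomialOn (rhs-polynomialOn r)
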